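{- Let $I$ be a Boolean edge CSP instance whose constraint relations are even $\Delta$-matroids, let $f$ be a valid edge labeling of $I$, and let $T$ be an $f$-DAG. Let $C^s$ be the constraint node of $T$ with the smallest timestamp $s$. Suppose that $C^s$ has exactly two incident edges in $T$: an incoming edge $uC^s$, where $u$ has no incident edges in $T$ other than $uC^s$, and an outgoing edge $C^sv$. Let $f^\star$ be obtained from $f$ by flipping the values on the edges $\{u,C\}$ and $\{v,C\}$, and let $T^\star$ be the digraph obtained from $T$ by removing the nodes $u$ and $C^s$ together with the two edges incident to $C^s$. Then $f^\star$ is a valid edge labeling of $I$ and $T^\star$ is an $f^\star$-DAG.
   Context: For a tuple $\alpha$, $\alpha\oplus v$ flips coordinate $v$. A nonempty $M\subseteq\{0,1\}^V$ is a $\Delta$-matroid if for all $\alpha,\beta\in M$ and $v$ with $\alpha(v)\ne\beta(v)$ there is $u$ with $\alpha(u)\ne\beta(u)$ and $\alpha\oplus v\oplus u\in M$ (meaning $\alpha\oplus v\in M$ if $u=v$); even if all tuples have the same parity of number of ones. A Boolean edge CSP instance $I=(V,\mathcal C)$: finite variable set $V$, finite constraint set $\mathcal C$, each $C$ with nonempty scope $\sigma_C\subseteq V$ and relation $C\subseteq\{0,1\}^{\sigma_C}$; each variable in the scopes of exactly two distinct constraints. $\mathcal E=\{\{v,C\}:v\in\sigma_C\}$. An edge labeling is $f:\mathcal E\to\{0,1\}$ with $f(C)(v)=f(\{v,C\})$; valid if $f(C)\in C$ for all $C$. An $f$-DAG is a directed graph $T$ with node set $V(T)\cup\mathcal C(T)$,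 $V(T)\subseteq V$, $\mathcal C(T)\subseteq\mathcal C\times\mathbb N$ (the node $(C,t)$ written $C^t$, $t$ its timestamp), satisfying: (1) every edge has the form $vC^t$ or $C^tv$ with $\{v,C\}\in\mathcal E$; (2) for each $\{v,C\}\in\mathcal E$ there is at most one $t$ with $vC^t$ or $C^tv$ in $E(T)$, and $vC^t$, $C^tv$ are never both present; (3) each $v\in V(T)$ has at most one incoming edge; (4) timestamps of nodes in $\mathcal C(T)$ are pairwise distinct, and their order extends to a total order $\prec$ on $V(T)\cup\mathcal C(T)$ with $\alpha\prec\beta$ for every edge $\alpha\beta$; (5) if $T$ contains $uC^t$ and one of $vC^t$, $C^tv$, then $f(C)\oplus u\oplus v\in C$; (6) (no shortcuts) if $T$ contains $uC^s$ and one of $vC^t$, $C^tv$ with $s<t$, then $f(C)\oplus u\oplus v\notin C$. -}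

module Defs where

open import Data.Nat using (ℕ; zero; suc; _+_; _≤_; _<_; _%_)
open import Data.Fin using (Fin; _≟_)
import Data.Fin as Fin
open import Data.Bool using (Bool; true; false; not; if_then_else_)
open import Data.Vec using (Vec; tabulate; lookup; _[_]%=_; map; sum)
open import Data.Product using (Σ; Σ-syntax; ∃; ∃-syntax; _×_; _,_)
open import Data.Sum using (_⊎_)
open import Data.Empty using (⊥)
open import Data.List using (List)
open import Data.List.Membership.Propositional using (_∈_)
open import Relation.Nullary using (¬_; does)
open import Relation.Binary.PropositionalEquality using (_≡_; _≢_)
open import Function.Definitions using (Injective)

flipAt : ∀ {k} → Vec Bool k → Fin k → Vec Bool k
flipAt α i = α [ i ]%= not

-- α ⊕ i ⊕ j, where (as in the paper) for j = i this means α ⊕ i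
flipStep : ∀ {k} → Vec Bool k → Fin k → Fin k → Vec Bool k
flipStep α i j = if does (i ≟ j) then flipAt α i else flipAt (flipAt α i) j

ones : ∀ {k} → Vec Bool k → ℕ
ones α = sum (map (λ b → if b then 1 else 0) α)

IsΔMatroid : ∀ {k} → (Vec Bool k → Set) → Set
IsΔMatroid {k} M =
  (∃[ α ] M α) ×
  (∀ α β → M α → M β → (i : Fin k) → lookup α i ≢ lookup β i →
     ∃[ j ] (lookup α j ≢ lookup β j × M (flipStep α i j)))

IsEven : ∀ {k} → (Vec Bool k → Set) → Set
IsEven M = ∀ α β → M α → M β → ones α % 2 ≡ ones β % 2

IsEvenΔMatroid : ∀ {k} → (Vec Bool k → Set) → Set
IsEvenΔMatroid M = IsΔMatroid M × IsEven M

-- Constraint C has scope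
-- σ_C = image of the injective map scope C : Fin (arity C) → Fin nV,
-- and the relation is a set of tuples indexed by σ_C (via this bijection).

record Instance : Set₁ where
  field
    nV nC     : ℕ
    arity     : Fin nC → ℕ
    nonempty  : ∀ C → 1 ≤ arity C
    scope     : (C : Fin nC) → Fin (arity C) → Fin nV
    scope-inj : ∀ C → Injective _≡_ _≡_ (scope C)
    rel       : (C : Fin nC) → Vec Bool (arity C) → Set

  _∈σ_ : Fin nV → Fin nC → Set
  v ∈σ C = ∃[ i ] scope C i ≡ v

  field
    twoConstraints : ∀ v → ∃[ C₁ ] ∃[ C₂ ]
      (C₁ ≢ C₂ × v ∈σ C₁ × v ∈σ C₂ × (∀ C → v ∈σ C → C ≡ C₁ ⊎ C ≡ C₂))

module _ (I : Instance) where
  open Instance I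

  -- edge labelings: f(C) is the tuple (f({v,C}))_{v ∈ σ_C}
  Labeling : Set
  Labeling = (C : Fin nC) → Vec Bool (arity C)

  Valid : Labeling → Set
  Valid f = ∀ C → rel C (f C)

  flipV : (C : Fin nC) → Vec Bool (arity C) → Fin nV → Vec Bool (arity C)
  flipV C α v = tabulate λ i →
    if does (scope C i ≟ v) then not (lookup α i) else lookup α i

  -- nodes of an f-DAG: variables v and constraint nodes C^t
  data Node : Set where
    var : Fin nV → Node
    con : Fin nC → ℕ → Node

  record Digraph : Set₁ where
    field
      vNode : Fin nV → Set
      cNode : Fin nC → ℕ → Set
      edge  : Node → Node → Set

    inT : Node → Set
    inT (var v)   = vNode v
    inT (con C t) = cNode C t

    touches : Fin nV → Fin nC → ℕ → Set
    touches v C t = edge (var v) (con C t) ⊎ edge (con C t) (var v)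

  record IsFDAG (f : Labeling) (T : Digraph) : Set₁ where
    open Digraph T
    field
      endpoints : ∀ a b → edge a b → inT a × inT b
      finite    : ∃[ ns ] (∀ a → inT a → a ∈ ns)
      cond1 : ∀ a b → edge a b →
        (∃[ v ] ∃[ C ] ∃[ t ] (a ≡ var v × b ≡ con C t × v ∈σ C)) ⊎
        (∃[ v ] ∃[ C ] ∃[ t ] (a ≡ con C t × b ≡ var v × v ∈σ C))
      cond2-unique : ∀ v C t t' → touches v C t → touches v C t' → t ≡ t'
      cond2-dir    : ∀ v C t → ¬ (edge (var v) (con C t) × edge (con C t) (var v))
      cond3 : ∀ a b v → edge a (var v) → edge b (var v) → a ≡ b
      cond4-distinct : ∀ C C' t → cNode C t → cNode C' t → C ≡ C'
      cond4-order : Σ[ _≺_ ∈ (Node → Node → Set) ]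
        ( (∀ a → inT a → ¬ (a ≺ a))
        × (∀ a b c → inT a → inT b → inT c → a ≺ b → b ≺ c → a ≺ c)
        × (∀ a b → inT a → inT b → a ≢ b → (a ≺ b) ⊎ (b ≺ a))
        × (∀ C C' s t → cNode C s → cNode C' t → s < t → con C s ≺ con C' t)
        × (∀ a b → edge a b → a ≺ b) )
      cond5 : ∀ u v C t → edge (var u) (con C t) → touches v C t →
        rel C (flipV C (flipV C (f C) u) v)
      cond6 : ∀ u v C s t → edge (var u) (con C s) → touches v C t → s < t →
        ¬ rel C (flipV C (flipV C (f C) u) v)

  flipEdges : Labeling → Fin nC → Fin nV → Fin nV → Labeling
  flipEdges f C u v C' =
    if does (C' ≟ C) then flipV C' (flipV C' (f C') u) v else f C'

  removeNodes : Digraph → Fin nV → Fin nC → ℕ → Digraph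
  removeNodes T u C s = record
    { vNode = λ x → Digraph.vNode T x × x ≢ u
    ; cNode = λ C' t → Digraph.cNode T C' t × con C' t ≢ con C s
    ; edge  = λ a b → Digraph.edge T a b
                × a ≢ var u × b ≢ var u × a ≢ con C s × b ≢ con C s
    }

-- Flipping {u,C} and {v,C} changes only the tuple of C, into f(C) ⊕ u ⊕ v, which lies in C by
-- condition (5) for the edges uC^s, C^sv; every other constraint keeps its labels, so all
-- conditions for the remaining nodes are inherited from T.  What is left are conditions (5) and
-- (6) at nodes C^t with t > s, where the new tuple is f(C) ⊕ u ⊕ v instead of f(C).  Both
-- follow from one exchange property of even Δ-matroids: if α and α ⊕ w ⊕ a ⊕ b ⊕ c both lie in
-- M, then so does α ⊕ w ⊕ a, α ⊕ w ⊕ b or α ⊕ w ⊕ c (parity forbids flipping w alone).  Taken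
-- with pivot u for (5) and pivot v for (6), every unwanted alternative is ruled out by the
-- no-shortcut condition (6), mostly at C^s, whose timestamp is the smallest.
module Submission where

open import Defs
open import Data.Nat using (ℕ; suc; _%_; _≤_; _<_)
open import Data.Nat.Properties using (≤∧≢⇒<; >⇒≢)
open import Data.Fin using (Fin; _≟_)
import Data.Fin as Fin
open import Data.Bool using (Bool; true; false; not; if_then_else_; _xor_)
open import Data.Bool.Properties using (xor-comm; not-¬)
open import Data.Bool.Solver using (module xor-∧-Solver)
open xor-∧-Solver using (solve; _:+_; _:=_)
open import Data.Vec using (Vec; _∷_; lookup; tabulate)
open import Data.Vec.Properties using (lookup∘tabulate; lookup∘updateAt; lookup∘updateAt′)
open import Data.Vec.Relation.Binary.Pointwise.Extensional using (ext; Pointwise-≡⇒≡)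
open import Data.List using (List; []; _∷_; foldl)
open import Data.Product using (Σ-syntax; ∃-syntax; _×_; _,_; proj₁; proj₂)
open import Data.Sum using (_⊎_; inj₁; inj₂; [_,_]′)
import Data.Sum as Sum
open import Data.Empty using (⊥; ⊥-elim)
open import Function using (_∘_)
open import Function.Definitions using (Injective)
open import Relation.Nullary using (¬_; does; yes; no; contradiction)
open import Relation.Nullary.Decidable using (dec-true; dec-false)
open import Relation.Binary.PropositionalEquality

ones-flipAt : ∀ {k} (α : Vec Bool k) i →
  suc (ones (flipAt α i)) ≡ ones α ⊎ ones (flipAt α i) ≡ suc (ones α)
ones-flipAt (true  ∷ α) Fin.zero    = inj₁ refl
ones-flipAt (false ∷ α) Fin.zero    = inj₂ refl
ones-flipAt (true  ∷ α) (Fin.suc i) with ones-flipAt α i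
... | inj₁ eq = inj₁ (cong suc eq)
... | inj₂ eq = inj₂ (cong suc eq)
ones-flipAt (false ∷ α) (Fin.suc i) = ones-flipAt α i

n%2≢1+n%2 : ∀ n → n % 2 ≢ suc n % 2
n%2≢1+n%2 ℕ.zero    ()
n%2≢1+n%2 (ℕ.suc n) eq = n%2≢1+n%2 n (sym eq)

module _ {k} {M : Vec Bool k → Set} where

  flipAt-∉ : IsEven M → ∀ {α} i → M α → ¬ M (flipAt α i)
  flipAt-∉ even {α} i Mα Mα⊕i with ones-flipAt α i | even _ _ Mα⊕i Mα
  ... | inj₁ eq | same = n%2≢1+n%2 (ones (flipAt α i)) (trans same (cong (_% 2) (sym eq)))
  ... | inj₂ eq | same = n%2≢1+n%2 (ones α) (trans (sym same) (cong (_% 2) eq))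

  even-exchange : IsEvenΔMatroid M → ∀ {α β} i → M α → M β → lookup α i ≢ lookup β i →
    ∃[ j ] (j ≢ i × lookup α j ≢ lookup β j × M (flipAt (flipAt α i) j))
  even-exchange ((_ , exchange) , even) {α} {β} i Mα Mβ αᵢ≢βᵢ
    with exchange α β Mα Mβ i αᵢ≢βᵢ
  ... | j , αⱼ≢βⱼ , Mα⊕i⊕j with i ≟ j
  ...   | yes refl = ⊥-elim (flipAt-∉ even i Mα Mα⊕i⊕j)
  ...   | no i≢j   = j , (λ j≡i → i≢j (sym j≡i)) , αⱼ≢βⱼ , Mα⊕i⊕j

module VariableFlips {n m : ℕ} (sc : Fin n → Fin m) where

  infixl 6 _⊕_ _⊕*_

  hit : Fin m → Fin n → Bool
  hit w k = does (sc k ≟ w)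

  -- `flipV I C` is `_⊕_` for `sc = scope C`, definitionally.
  _⊕_ : Vec Bool n → Fin m → Vec Bool n
  α ⊕ w = tabulate λ k → if hit w k then not (lookup α k) else lookup α k

  _⊕*_ : Vec Bool n → List (Fin m) → Vec Bool n
  _⊕*_ = foldl _⊕_

  lookup-⊕ : ∀ α w k → lookup (α ⊕ w) k ≡ (if hit w k then not (lookup α k) else lookup α k)
  lookup-⊕ α w k = lookup∘tabulate _ k

  lookup-⊕-≢ : ∀ α {w k} → sc k ≢ w → lookup (α ⊕ w) k ≡ lookup α k
  lookup-⊕-≢ α {w} {k} k≢w rewrite lookup-⊕ α w k | dec-false (sc k ≟ w) k≢w = refl

  lookup-⊕-≡ : ∀ α {w k} → sc k ≡ w → lookup (α ⊕ w) k ≡ not (lookup α k)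
  lookup-⊕-≡ α {w} {k} k≡w rewrite lookup-⊕ α w k | dec-true (sc k ≟ w) k≡w = refl

  lookup-⊕-xor : ∀ α w k → lookup (α ⊕ w) k ≡ lookup α k xor hit w k
  lookup-⊕-xor α w k rewrite lookup-⊕ α w k with hit w k
  ... | true  = xor-comm true (lookup α k)
  ... | false = xor-comm false (lookup α k)

  lookup-⊕³-≢ : ∀ α {a b c} k → sc k ≢ a → sc k ≢ b → sc k ≢ c → lookup (α ⊕ a ⊕ b ⊕ c) k ≡ lookup α k
  lookup-⊕³-≢ α {a} {b} k k≢a k≢b k≢c =
    trans (lookup-⊕-≢ (α ⊕ a ⊕ b) k≢c) (trans (lookup-⊕-≢ (α ⊕ a) k≢b) (lookup-⊕-≢ α k≢a))

  bitFlips : Fin n → Bool → List (Fin m) → Bool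
  bitFlips k = foldl λ b w → b xor hit w k

  lookup-⊕* : ∀ α ws k → lookup (α ⊕* ws) k ≡ bitFlips k (lookup α k) ws
  lookup-⊕* α []       k = refl
  lookup-⊕* α (w ∷ ws) k = trans (lookup-⊕* (α ⊕ w) ws k) (cong (λ b → bitFlips k b ws) (lookup-⊕-xor α w k))

  -- Reduces identities between flip sequences to Boolean-ring identities, for the xor-∧ solver.
  ⊕*-cong : ∀ α ws ws' → (∀ k b → bitFlips k b ws ≡ bitFlips k b ws') → α ⊕* ws ≡ α ⊕* ws'
  ⊕*-cong α ws ws' same = Pointwise-≡⇒≡ (ext λ k →
    trans (lookup-⊕* α ws k) (trans (same k (lookup α k)) (sym (lookup-⊕* α ws' k))))

  module _ (injective : Injective _≡_ _≡_ sc) where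

    flipAt-⊕ : ∀ α i → flipAt α i ≡ α ⊕ sc i
    flipAt-⊕ α i = Pointwise-≡⇒≡ (ext pointwise)
      where
      pointwise : ∀ k → lookup (flipAt α i) k ≡ lookup (α ⊕ sc i) k
      pointwise k with k ≟ i
      ... | yes refl = trans (lookup∘updateAt k α) (sym (lookup-⊕-≡ α refl))
      ... | no k≢i   = trans (lookup∘updateAt′ k i k≢i α) (sym (lookup-⊕-≢ α (λ eq → k≢i (injective eq))))

    module _ {M : Vec Bool n → Set} (evenΔ : IsEvenΔMatroid M) where

      four-exchange : ∀ {α w a b c} i → sc i ≡ w → w ≢ a → w ≢ b → w ≢ c →
        M α → M (α ⊕ w ⊕ a ⊕ b ⊕ c) → M (α ⊕ w ⊕ a) ⊎ M (α ⊕ w ⊕ b) ⊎ M (α ⊕ w ⊕ c)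
      four-exchange {α} {w} {a} {b} {c} i refl w≢a w≢b w≢c Mα Mβ
        with even-exchange evenΔ i Mα Mβ
               (λ eq → not-¬ refl (trans eq (trans (lookup-⊕³-≢ (α ⊕ w) i w≢a w≢b w≢c) (lookup-⊕-≡ α refl))))
      ... | j , j≢i , differ-at-j , Mα⊕i⊕j
        rewrite flipAt-⊕ α i | flipAt-⊕ (α ⊕ w) j with sc j ≟ a | sc j ≟ b | sc j ≟ c
      ... | yes refl | _        | _        = inj₁ Mα⊕i⊕j
      ... | no _     | yes refl | _        = inj₂ (inj₁ Mα⊕i⊕j)
      ... | no _     | no _     | yes refl = inj₂ (inj₂ Mα⊕i⊕j)
      ... | no j≢a   | no j≢b   | no j≢c   = contradiction
        (sym (trans (lookup-⊕³-≢ (α ⊕ w) j j≢a j≢b j≢c) (lookup-⊕-≢ α (λ eq → j≢i (injective eq)))))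
        differ-at-j

      pairs-⊕-∈ : ∀ {x u v u' v'} i → sc i ≡ u → u ≢ v → u ≢ u' → u ≢ v' →
        M (x ⊕ u ⊕ v) → M (x ⊕ u' ⊕ v') → ¬ M (x ⊕ u ⊕ v') → ¬ M (x ⊕ u ⊕ u') →
        M (x ⊕ u ⊕ v ⊕ u' ⊕ v')
      pairs-⊕-∈ {x} {u} {v} {u'} {v'} i i↦u u≢v u≢u' u≢v' Mx⊕u⊕v Mx⊕u'⊕v' ∉x⊕u⊕v' ∉x⊕u⊕u' =
        [ subst M pair-swap
        , [ ⊥-elim ∘ ∉x⊕u⊕v' ∘ subst M cancel-u' , ⊥-elim ∘ ∉x⊕u⊕u' ∘ subst M cancel-v' ]′ ]′
        (four-exchange {x ⊕ u' ⊕ v'} {u} {v} {u'} {v'} i i↦u u≢v u≢u' u≢v'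
           Mx⊕u'⊕v' (subst M regroup Mx⊕u⊕v))
        where
        regroup : x ⊕ u ⊕ v ≡ x ⊕ u' ⊕ v' ⊕ u ⊕ v ⊕ u' ⊕ v'
        regroup = ⊕*-cong x (u ∷ v ∷ []) (u' ∷ v' ∷ u ∷ v ∷ u' ∷ v' ∷ []) λ k b →
          solve 5 (λ x u v u' v' → x :+ u :+ v := x :+ u' :+ v' :+ u :+ v :+ u' :+ v') refl
            b (hit u k) (hit v k) (hit u' k) (hit v' k)
        pair-swap : x ⊕ u' ⊕ v' ⊕ u ⊕ v ≡ x ⊕ u ⊕ v ⊕ u' ⊕ v'
        pair-swap = ⊕*-cong x (u' ∷ v' ∷ u ∷ v ∷ []) (u ∷ v ∷ u' ∷ v' ∷ []) λ k b →
          solve 5 (λ x u v u' v' → x :+ u' :+ v' :+ u :+ v := x :+ u :+ v :+ u' :+ v') refl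
            b (hit u k) (hit v k) (hit u' k) (hit v' k)
        cancel-u' : x ⊕ u' ⊕ v' ⊕ u ⊕ u' ≡ x ⊕ u ⊕ v'
        cancel-u' = ⊕*-cong x (u' ∷ v' ∷ u ∷ u' ∷ []) (u ∷ v' ∷ []) λ k b →
          solve 5 (λ x u v u' v' → x :+ u' :+ v' :+ u :+ u' := x :+ u :+ v') refl
            b (hit u k) (hit v k) (hit u' k) (hit v' k)
        cancel-v' : x ⊕ u' ⊕ v' ⊕ u ⊕ v' ≡ x ⊕ u ⊕ u'
        cancel-v' = ⊕*-cong x (u' ∷ v' ∷ u ∷ v' ∷ []) (u ∷ u' ∷ []) λ k b →
          solve 5 (λ x u v u' v' → x :+ u' :+ v' :+ u :+ v' := x :+ u :+ u') refl
            b (hit u k) (hit v k) (hit u' k) (hit v' k)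

      pairs-⊕-∉ : ∀ {x u v u' v'} i → sc i ≡ v → v ≢ u → v ≢ u' → v ≢ v' →
        M x → ¬ M (x ⊕ u' ⊕ v') → ¬ M (x ⊕ u ⊕ v') → ¬ M (x ⊕ u ⊕ u') →
        ¬ M (x ⊕ u ⊕ v ⊕ u' ⊕ v')
      pairs-⊕-∉ {x} {u} {v} {u'} {v'} i i↦v v≢u v≢u' v≢v' Mx ∉x⊕u'⊕v' ∉x⊕u⊕v' ∉x⊕u⊕u' Mγ =
        [ ∉x⊕u'⊕v' ∘ subst M cancel-u , [ ∉x⊕u⊕v' ∘ subst M cancel-u' , ∉x⊕u⊕u' ∘ subst M cancel-v' ]′ ]′
        (four-exchange {x ⊕ u ⊕ v ⊕ u' ⊕ v'} {v} {u} {u'} {v'} i i↦v v≢u v≢u' v≢v'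
           Mγ (subst M regroup Mx))
        where
        regroup : x ≡ x ⊕ u ⊕ v ⊕ u' ⊕ v' ⊕ v ⊕ u ⊕ u' ⊕ v'
        regroup = ⊕*-cong x [] (u ∷ v ∷ u' ∷ v' ∷ v ∷ u ∷ u' ∷ v' ∷ []) λ k b →
          solve 5 (λ x u v u' v' → x := x :+ u :+ v :+ u' :+ v' :+ v :+ u :+ u' :+ v') refl
            b (hit u k) (hit v k) (hit u' k) (hit v' k)
        cancel-u : x ⊕ u ⊕ v ⊕ u' ⊕ v' ⊕ v ⊕ u ≡ x ⊕ u' ⊕ v'
        cancel-u = ⊕*-cong x (u ∷ v ∷ u' ∷ v' ∷ v ∷ u ∷ []) (u' ∷ v' ∷ []) λ k b →
          solve 5 (λ x u v u' v' → x :+ u :+ v :+ u' :+ v' :+ v :+ u := x :+ u' :+ v') refl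
            b (hit u k) (hit v k) (hit u' k) (hit v' k)
        cancel-u' : x ⊕ u ⊕ v ⊕ u' ⊕ v' ⊕ v ⊕ u' ≡ x ⊕ u ⊕ v'
        cancel-u' = ⊕*-cong x (u ∷ v ∷ u' ∷ v' ∷ v ∷ u' ∷ []) (u ∷ v' ∷ []) λ k b →
          solve 5 (λ x u v u' v' → x :+ u :+ v :+ u' :+ v' :+ v :+ u' := x :+ u :+ v') refl
            b (hit u k) (hit v k) (hit u' k) (hit v' k)
        cancel-v' : x ⊕ u ⊕ v ⊕ u' ⊕ v' ⊕ v ⊕ v' ≡ x ⊕ u ⊕ u'
        cancel-v' = ⊕*-cong x (u ∷ v ∷ u' ∷ v' ∷ v ∷ v' ∷ []) (u ∷ u' ∷ []) λ k b →
          solve 5 (λ x u v u' v' → x :+ u :+ v :+ u' :+ v' :+ v :+ v' := x :+ u :+ u') refl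
            b (hit u k) (hit v k) (hit u' k) (hit v' k)

module _ (I : Instance) where
  open Instance I

  flipEdges-valid : ∀ f C u v → Valid I f → rel C (flipV I C (flipV I C (f C) u) v) →
    Valid I (flipEdges I f C u v)
  flipEdges-valid f C u v valid valid-at-C C' with C' ≟ C
  ... | yes refl = valid-at-C
  ... | no _     = valid C'

  TopologicalOrder : Digraph I → Set₁
  TopologicalOrder T = Σ[ _≺_ ∈ (Node I → Node I → Set) ]
    ( (∀ a → inT a → ¬ (a ≺ a))
    × (∀ a b c → inT a → inT b → inT c → a ≺ b → b ≺ c → a ≺ c)
    × (∀ a b → inT a → inT b → a ≢ b → (a ≺ b) ⊎ (b ≺ a))
    × (∀ C C' s t → cNode C s → cNode C' t → s < t → con C s ≺ con C' t)
    × (∀ a b → edge a b → a ≺ b) )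
    where open Digraph T

  module _ {f : Labeling I} {T : Digraph I} (D : IsFDAG I f T) where
    open Digraph T
    open IsFDAG D

    in-edge-scope : ∀ {w C t} → edge (var w) (con C t) → w ∈σ C
    in-edge-scope e with cond1 _ _ e
    ... | inj₁ (_ , _ , _ , refl , refl , w∈σC) = w∈σC
    ... | inj₂ (_ , _ , _ , () , _)

    out-edge-scope : ∀ {w C t} → edge (con C t) (var w) → w ∈σ C
    out-edge-scope e with cond1 _ _ e
    ... | inj₁ (_ , _ , _ , () , _)
    ... | inj₂ (_ , _ , _ , refl , refl , w∈σC) = w∈σC

    touches-cNode : ∀ {w C t} → touches w C t → cNode C t
    touches-cNode (inj₁ e) = proj₂ (endpoints _ _ e)
    touches-cNode (inj₂ e) = proj₁ (endpoints _ _ e)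

  module Removal (T : Digraph I) (u : Fin nV) (C : Fin nC) (s : ℕ) where
    open Digraph T
    module T⋆ = Digraph (removeNodes I T u C s)

    edge⋆→edge : ∀ {a b} → T⋆.edge a b → edge a b
    edge⋆→edge = proj₁

    touches⋆→touches : ∀ {w C' t} → T⋆.touches w C' t → touches w C' t
    touches⋆→touches = Sum.map proj₁ proj₁

    touches⋆-fresh : ∀ {w C' t} → T⋆.touches w C' t → con C' t ≢ con C s
    touches⋆-fresh (inj₁ (_ , _ , _ , _ , ≢C^s)) = ≢C^s
    touches⋆-fresh (inj₂ (_ , _ , _ , ≢C^s , _)) = ≢C^s

    inT⋆→inT : ∀ a → T⋆.inT a → inT a
    inT⋆→inT (var _)   = proj₁
    inT⋆→inT (con _ _) = proj₁

    inT→inT⋆ : ∀ a → inT a → a ≢ var u → a ≢ con C s → T⋆.inT a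
    inT→inT⋆ (var w)    a∈T ≢u _    = a∈T , λ w≡u → ≢u (cong var w≡u)
    inT→inT⋆ (con C' t) a∈T _  ≢C^s = a∈T , ≢C^s

    restrict-order : TopologicalOrder T → TopologicalOrder (removeNodes I T u C s)
    restrict-order (_≺_ , irrefl , transitive , total , by-stamp , along-edges) =
      _≺_ , (λ a a∈ → irrefl a (inT⋆→inT a a∈))
          , (λ a b c a∈ b∈ c∈ → transitive a b c (inT⋆→inT a a∈) (inT⋆→inT b b∈) (inT⋆→inT c c∈))
          , (λ a b a∈ b∈ → total a b (inT⋆→inT a a∈) (inT⋆→inT b b∈))
          , (λ C₁ C₂ t₁ t₂ p q → by-stamp C₁ C₂ t₁ t₂ (proj₁ p) (proj₁ q))
          , (λ a b e → along-edges a b (edge⋆→edge e))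

    removeNodes-isFDAG : ∀ {f g} → IsFDAG I f T →
      (∀ u' v' C' t → T⋆.edge (var u') (con C' t) → T⋆.touches v' C' t →
         rel C' (flipV I C' (flipV I C' (g C') u') v')) →
      (∀ u' v' C' s' t → T⋆.edge (var u') (con C' s') → T⋆.touches v' C' t → s' < t →
         ¬ rel C' (flipV I C' (flipV I C' (g C') u') v')) →
      IsFDAG I g (removeNodes I T u C s)
    removeNodes-isFDAG D cond5⋆ cond6⋆ = record
      { endpoints      = λ a b (e , a≢u , b≢u , a≢C^s , b≢C^s) →
                           inT→inT⋆ a (proj₁ (endpoints a b e)) a≢u a≢C^s ,
                           inT→inT⋆ b (proj₂ (endpoints a b e)) b≢u b≢C^s
      ; finite         = proj₁ finite , λ a a∈T⋆ → proj₂ finite a (inT⋆→inT a a∈T⋆)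
      ; cond1          = λ a b e → cond1 a b (edge⋆→edge e)
      ; cond2-unique   = λ w C' t t' p q → cond2-unique w C' t t' (touches⋆→touches p) (touches⋆→touches q)
      ; cond2-dir      = λ w C' t (p , q) → cond2-dir w C' t (edge⋆→edge p , edge⋆→edge q)
      ; cond3          = λ a b w p q → cond3 a b w (edge⋆→edge p) (edge⋆→edge q)
      ; cond4-distinct = λ C₁ C₂ t p q → cond4-distinct C₁ C₂ t (proj₁ p) (proj₁ q)
      ; cond4-order    = restrict-order cond4-order
      ; cond5          = cond5⋆
      ; cond6          = cond6⋆
      }
      where
      open IsFDAG D

  module Reduction (evenΔ : ∀ C → IsEvenΔMatroid (rel C))
    {f : Labeling I} (valid : Valid I f) {T : Digraph I} (D : IsFDAG I f T)
    {C : Fin nC} {s : ℕ} {u v : Fin nV}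
    (s-min : ∀ C' t → Digraph.cNode T C' t → s ≤ t)
    (u→C^s : Digraph.edge T (var u) (con C s)) (C^s→v : Digraph.edge T (con C s) (var v)) where
    open Digraph T
    open IsFDAG D
    open Removal T u C s
    open VariableFlips (scope C) using (pairs-⊕-∈; pairs-⊕-∉)

    f⋆ : Labeling I
    f⋆ = flipEdges I f C u v

    u≢v : u ≢ v
    u≢v refl = cond2-dir u C s (u→C^s , C^s→v)

    u-only-at-C^s : ∀ {w t} → touches w C t → t ≢ s → u ≢ w
    u-only-at-C^s w~C^t t≢s refl = t≢s (cond2-unique u C _ s w~C^t (inj₁ u→C^s))

    v-only-at-C^s : ∀ {w t} → touches w C t → t ≢ s → v ≢ w
    v-only-at-C^s w~C^t t≢s refl = t≢s (cond2-unique v C _ s w~C^t (inj₂ C^s→v))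

    later : ∀ {w t} → T⋆.touches w C t → s < t
    later {t = t} w~C^t = ≤∧≢⇒< (s-min C t (touches-cNode D (touches⋆→touches w~C^t)))
                                 (λ s≡t → touches⋆-fresh w~C^t (cong (con C) (sym s≡t)))

    cond5⋆ : ∀ u' v' C' t → T⋆.edge (var u') (con C' t) → T⋆.touches v' C' t →
      rel C' (flipV I C' (flipV I C' (f⋆ C') u') v')
    cond5⋆ u' v' C' t u'→C'^t v'~C'^t with C' ≟ C
    ... | no _ =
      cond5 u' v' C' t (edge⋆→edge u'→C'^t) (touches⋆→touches v'~C'^t)
    ... | yes refl =
      pairs-⊕-∈ (scope-inj C) (evenΔ C) {f C} {u} {v} {u'} {v'} (proj₁ (in-edge-scope D u→C^s)) (proj₂ (in-edge-scope D u→C^s))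
        u≢v (u-only-at-C^s u'~C^t t≢s) (u-only-at-C^s v'~C^t t≢s)
        (cond5 u v C s u→C^s (inj₂ C^s→v)) (cond5 u' v' C t (edge⋆→edge u'→C'^t) v'~C^t)
        (cond6 u v' C s t u→C^s v'~C^t s<t) (cond6 u u' C s t u→C^s u'~C^t s<t)
      where
      u'~C^t = inj₁ (edge⋆→edge u'→C'^t)
      v'~C^t = touches⋆→touches v'~C'^t
      s<t = later v'~C'^t
      t≢s = >⇒≢ s<t

    cond6⋆ : ∀ u' v' C' s' t → T⋆.edge (var u') (con C' s') → T⋆.touches v' C' t → s' < t →
      ¬ rel C' (flipV I C' (flipV I C' (f⋆ C') u') v')
    cond6⋆ u' v' C' s' t u'→C'^s' v'~C'^t s'<t with C' ≟ C
    ... | no _ =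
      cond6 u' v' C' s' t (edge⋆→edge u'→C'^s') (touches⋆→touches v'~C'^t) s'<t
    ... | yes refl =
      pairs-⊕-∉ (scope-inj C) (evenΔ C) {f C} {u} {v} {u'} {v'} (proj₁ (out-edge-scope D C^s→v)) (proj₂ (out-edge-scope D C^s→v))
        (u≢v ∘ sym) (v-only-at-C^s u'~C^s' (>⇒≢ s<s')) (v-only-at-C^s v'~C^t (>⇒≢ s<t))
        (valid C) (cond6 u' v' C s' t (edge⋆→edge u'→C'^s') v'~C^t s'<t)
        (cond6 u v' C s t u→C^s v'~C^t s<t) (cond6 u u' C s s' u→C^s u'~C^s' s<s')
      where
      u'~C^s' = inj₁ (edge⋆→edge u'→C'^s')
      v'~C^t = touches⋆→touches v'~C'^t
      s<s' = later (inj₁ u'→C'^s')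
      s<t = later v'~C'^t

mainTheorem17 : (I : Instance) →
    (∀ C → IsEvenΔMatroid (Instance.rel I C)) →
    (f : Labeling I) → Valid I f →
    (T : Digraph I) → IsFDAG I f T →
    (C : Fin (Instance.nC I)) (s : ℕ) (u v : Fin (Instance.nV I)) →
    Digraph.cNode T C s →
    (∀ C' t → Digraph.cNode T C' t → s ≤ t) →
    Digraph.edge T (var u) (con C s) →
    Digraph.edge T (con C s) (var v) →
    (∀ a → Digraph.edge T a (con C s) → a ≡ var u) →
    (∀ b → Digraph.edge T (con C s) b → b ≡ var v) →
    (∀ a → Digraph.edge T a (var u) → ⊥) →
    (∀ b → Digraph.edge T (var u) b → b ≡ con C s) →
    Valid I (flipEdges I f C u v) ×
    IsFDAG I (flipEdges I f C u v) (removeNodes I T u C s)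
mainTheorem17 I evenΔ f valid T D C s u v _ s-min u→C^s C^s→v _ _ _ _ =
  flipEdges-valid I f C u v valid (IsFDAG.cond5 D u v C s u→C^s (inj₂ C^s→v)) ,
  Removal.removeNodes-isFDAG I T u C s D cond5⋆ cond6⋆
  where open Reduction I evenΔ valid D s-min u→C^s C^s→v
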